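{- ${\tt BWT}(u_k) = \mathtt{a}^{2k}(\prod_{i=1}^k\mathtt{b}\,\text{\tt \#}_i)\, \text{\tt \&}_k \,(\prod_{i=1}^{k-1} \text{\tt \&}_{i})$ and $r(u_k)=3k+1$.
   Context: Let $k\ge 1$ and let $\Sigma = \{\mathtt{a},\mathtt{b}\} \cup \bigcup_{i\in[1,k]} \{\text{\tt \#}_i,\text{\tt \&}_i\}$ be ordered as $\text{\tt \#}_1< \text{\tt \&}_1 < \text{\tt \#}_2 < \text{\tt \&}_2 < \dots < \text{\tt \#}_k < \text{\tt \&}_k < \mathtt{a} < \mathtt{b}$. Define $u_k = \prod_{i=1}^k \mathtt{b}\,\mathtt{a}\,\text{\tt \#}_i\,\mathtt{a}\,\text{\tt \&}_i$ (so $|u_k|=5k$). For a string $w$ of length $n$, ${\tt BWT}(w)$ is the string of last characters of the lexicographically sorted rotations of $w$, and $r(w)$ is the number of runs (maximal equal-symbol blocks) in ${\tt BWT}(w)$. -}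

module Defs where

open import Data.Nat using (ℕ; zero; suc; _+_; _*_; _<ᵇ_; _≡ᵇ_)
open import Data.Bool using (Bool; true; false; if_then_else_)
open import Data.Fin using (Fin; toℕ; fromℕ; inject₁)
open import Data.List using (List; []; _∷_; _++_; map; concatMap; drop; take; length; upTo; allFin; replicate)

-- The alphabet Σ for parameter k: #_i, &_i (i ∈ Fin k, i.e. indices 1..k shifted to 0..k-1), a, b.
data Sym (k : ℕ) : Set where
  hash : Fin k → Sym k
  amp  : Fin k → Sym k
  sa   : Sym k
  sb   : Sym k

rank : {k : ℕ} → Sym k → ℕ
rank         (hash i) = 2 * toℕ i
rank         (amp i)  = suc (2 * toℕ i)
rank {k}     sa       = 2 * k
rank {k}     sb       = suc (2 * k)

_==ˢ_ : {k : ℕ} → Sym k → Sym k → Bool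
x ==ˢ y = rank x ≡ᵇ rank y

lex≤ : {k : ℕ} → List (Sym k) → List (Sym k) → Bool
lex≤ []       _        = true
lex≤ (_ ∷ _)  []       = false
lex≤ (x ∷ xs) (y ∷ ys) =
  if rank x <ᵇ rank y then true
  else if rank x ≡ᵇ rank y then lex≤ xs ys else false

insertLex : {k : ℕ} → List (Sym k) → List (List (Sym k)) → List (List (Sym k))
insertLex x []       = x ∷ []
insertLex x (y ∷ ys) = if lex≤ x y then x ∷ y ∷ ys else y ∷ insertLex x ys

sortLex : {k : ℕ} → List (List (Sym k)) → List (List (Sym k))
sortLex []       = []
sortLex (x ∷ xs) = insertLex x (sortLex xs)

rotations : {A : Set} → List A → List (List A)
rotations w = map (λ j → drop j w ++ take j w) (upTo (length w))

lastL : {A : Set} → List A → List A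
lastL []           = []
lastL (x ∷ [])     = x ∷ []
lastL (_ ∷ y ∷ ys) = lastL (y ∷ ys)

BWT : {k : ℕ} → List (Sym k) → List (Sym k)
BWT w = concatMap lastL (sortLex (rotations w))

runs : {k : ℕ} → List (Sym k) → ℕ
runs []           = 0
runs (_ ∷ [])     = 1
runs (x ∷ y ∷ ys) = (if x ==ˢ y then 0 else 1) + runs (y ∷ ys)

r : {k : ℕ} → List (Sym k) → ℕ
r w = runs (BWT w)

u : (k : ℕ) → List (Sym k)
u k = concatMap (λ i → sb ∷ sa ∷ hash i ∷ sa ∷ amp i ∷ []) (allFin k)

bwtTarget : (m : ℕ) → List (Sym (suc m))
bwtTarget m =
  replicate (2 * suc m) sa
  ++ concatMap (λ i → sb ∷ hash i ∷ []) (allFin (suc m))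
  ++ amp (fromℕ m) ∷ map (λ i → amp (inject₁ i)) (allFin m)

-- The 5k rotations of u_k split into three groups: those starting with a separator #_i or &_i,
-- ordered by that symbol; those starting with a, ordered by the separator that follows; and those
-- starting with b a #_i, ordered by i. Concatenated in this order they form a strictly sorted
-- permutation of the rotations, which insertion sort must therefore return. The symbols preceding
-- them are a^{2k}, then b #_i for each i, then &_{i-1} for each i (cyclically, so &_k comes first).
-- In this string the block a^{2k} is one run and all later neighbours differ, so r(u_k) = 1 + 2k + k.

{-# OPTIONS --safe #-}
module Submission where

open import Defs
open import Data.Bool using (true; false; T)
open import Data.Bool.Properties using (T-≡)
open import Data.Empty using (⊥)
open import Data.Fin as Fin using (Fin; fromℕ; inject₁) renaming (zero to fzero; suc to fsuc)
open import Data.Fin.Properties using (toℕ-inject₁; toℕ-fromℕ; toℕ<n)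
open import Data.List
  using (List; []; _∷_; _++_; [_]; _∷ʳ_; map; concatMap; drop; take; length; applyUpTo; tabulate; allFin; replicate)
open import Data.List.Properties
  using (++-assoc; map-applyUpTo; map-tabulate; length-tabulate; length-map; length-++; concatMap-++)
open import Data.List.Membership.Propositional.Properties using (∈-∃++)
open import Data.List.Relation.Binary.Permutation.Propositional
  using (_↭_; ↭-refl; ↭-sym; ↭-trans; prep; swap; module PermutationReasoning)
open import Data.List.Relation.Binary.Permutation.Propositional.Properties
  using (↭-empty-inv; ∈-resp-↭; drop-mid; ++⁺ˡ; ++⁺; shift; shifts; ++-comm)
open import Data.List.Relation.Unary.All as All using (All; []; _∷_)
import Data.List.Relation.Unary.All.Properties as All
open import Data.List.Relation.Unary.AllPairs using (AllPairs; []; _∷_)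
import Data.List.Relation.Unary.AllPairs.Properties as AllPairs
open import Data.List.Relation.Unary.Any using (here)
open import Data.List.Relation.Unary.Linked as Linked using (Linked; []; [-]; _∷_)
open import Data.List.Relation.Unary.Linked.Properties as Linked using (Linked⇒AllPairs; AllPairs⇒Linked)
open import Data.Nat using (ℕ; NonZero; zero; suc; _+_; _*_; _<_; _≤_; s≤s)
open import Data.Nat.Properties
open import Data.Product using (_×_; _,_; proj₂)
open import Data.Sum using (_⊎_; inj₁; inj₂)
open import Function using (_∘_; id; Equivalence)
open import Relation.Binary.PropositionalEquality
  using (_≡_; _≢_; refl; sym; trans; cong; cong₂; module ≡-Reasoning)
open import Relation.Binary.Definitions using (tri<; tri≈; tri>)
open import Relation.Nullary using (¬_; contradiction)

T⇒≡true : ∀ {b} → T b → b ≡ true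
T⇒≡true = Equivalence.to T-≡

¬T⇒≡false : ∀ {b} → ¬ T b → b ≡ false
¬T⇒≡false {false} _  = refl
¬T⇒≡false {true}  ¬t = contradiction _ ¬t

applyUpTo-cong : ∀ {A : Set} {f g : ℕ → A} → (∀ j → f j ≡ g j) → ∀ n →
                 applyUpTo f n ≡ applyUpTo g n
applyUpTo-cong f≗g zero    = refl
applyUpTo-cong f≗g (suc n) = cong₂ _∷_ (f≗g 0) (applyUpTo-cong (f≗g ∘ suc) n)

concatMap-↭ : ∀ {A B : Set} {f g : A → List B} → (∀ x → f x ↭ g x) → ∀ xs →
              concatMap f xs ↭ concatMap g xs
concatMap-↭ f↭g []       = ↭-refl
concatMap-↭ f↭g (x ∷ xs) = ++⁺ (f↭g x) (concatMap-↭ f↭g xs)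

concatMap-++-↭ : ∀ {A B : Set} (f g : A → List B) xs →
                 concatMap (λ x → f x ++ g x) xs ↭ concatMap f xs ++ concatMap g xs
concatMap-++-↭ f g []       = ↭-refl
concatMap-++-↭ f g (x ∷ xs) = begin
  (f x ++ g x) ++ concatMap (λ x → f x ++ g x) xs  ↭⟨ ++⁺ˡ (f x ++ g x) (concatMap-++-↭ f g xs) ⟩
  (f x ++ g x) ++ F ++ G                           ≡⟨ ++-assoc (f x) (g x) (F ++ G) ⟩
  f x ++ g x ++ F ++ G                             ↭⟨ ++⁺ˡ (f x) (shifts (g x) F) ⟩
  f x ++ F ++ g x ++ G                             ≡⟨ sym (++-assoc (f x) F (g x ++ G)) ⟩
  (f x ++ F) ++ g x ++ G                           ∎
  where
  open PermutationReasoning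
  F = concatMap f xs
  G = concatMap g xs

All-concatMap⁺ : ∀ {A B : Set} {P : B → Set} {f : A → List B} → (∀ x → All P (f x)) → ∀ xs →
                 All P (concatMap f xs)
All-concatMap⁺ Pf xs = All.concat⁺ (All.map⁺ (All.universal Pf xs))

lastL-∷ʳ : ∀ {A : Set} (xs : List A) y → lastL (xs ∷ʳ y) ≡ [ y ]
lastL-∷ʳ []            y = refl
lastL-∷ʳ (x ∷ [])      y = refl
lastL-∷ʳ (x ∷ x′ ∷ xs) y = lastL-∷ʳ (x′ ∷ xs) y

lastL-++-∷ʳ : ∀ {A : Set} (xs ys : List A) y → lastL (xs ++ ys ∷ʳ y) ≡ [ y ]
lastL-++-∷ʳ xs ys y = trans (cong lastL (sym (++-assoc xs ys [ y ]))) (lastL-∷ʳ (xs ++ ys) y)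

last⁺ : ∀ {A : Set} → A → List A → A
last⁺ x []       = x
last⁺ x (y ∷ ys) = last⁺ y ys

init⁺ : ∀ {A : Set} → A → List A → List A
init⁺ x []       = []
init⁺ x (y ∷ ys) = x ∷ init⁺ y ys

last⁺-tabulate : ∀ {A : Set} n (f : Fin (suc n) → A) →
                 last⁺ (f fzero) (tabulate (f ∘ fsuc)) ≡ f (fromℕ n)
last⁺-tabulate zero    f = refl
last⁺-tabulate (suc n) f = last⁺-tabulate n (f ∘ fsuc)

init⁺-tabulate : ∀ {A : Set} n (f : Fin (suc n) → A) →
                 init⁺ (f fzero) (tabulate (f ∘ fsuc)) ≡ tabulate (f ∘ inject₁)
init⁺-tabulate zero    f = refl
init⁺-tabulate (suc n) f = cong (f fzero ∷_) (init⁺-tabulate n (f ∘ fsuc))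

allFin-↗ : ∀ n → Linked Fin._<_ (allFin n)
allFin-↗ n = AllPairs⇒Linked (AllPairs.tabulate⁺-< id)

m<n⇒1+2m<2n : ∀ {m n} → m < n → suc (2 * m) < 2 * n
m<n⇒1+2m<2n {m} m<n = ≤-trans (≤-reflexive (sym (*-suc 2 m))) (*-monoʳ-≤ 2 m<n)

module _ {k : ℕ} where

  lex≤-head< : ∀ (c d : Sym k) xs ys → rank c < rank d → lex≤ (c ∷ xs) (d ∷ ys) ≡ true
  lex≤-head< _ _ _ _ c<d rewrite T⇒≡true (<⇒<ᵇ c<d) = refl

  lex≤-head> : ∀ (c d : Sym k) xs ys → rank d < rank c → lex≤ (c ∷ xs) (d ∷ ys) ≡ false
  lex≤-head> _ _ _ _ d<c
    rewrite ¬T⇒≡false (<⇒≯ d<c ∘ <ᵇ⇒< _ _) | ¬T⇒≡false (>⇒≢ d<c ∘ ≡ᵇ⇒≡ _ _) = refl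

  lex≤-head≡ : ∀ (c d : Sym k) xs ys → rank c ≡ rank d → lex≤ (c ∷ xs) (d ∷ ys) ≡ lex≤ xs ys
  lex≤-head≡ _ _ _ _ c≡d
    rewrite ¬T⇒≡false (<-irrefl c≡d ∘ <ᵇ⇒< _ _) | T⇒≡true (≡⇒≡ᵇ _ _ c≡d) = refl

  -- A record rather than a synonym, so that both strings can be inferred from a proof.
  record _≺_ (xs ys : List (Sym k)) : Set where
    constructor ≺-intro
    field ≰ : lex≤ ys xs ≡ false
  open _≺_

  head<⇒≺ : ∀ {c d : Sym k} {xs ys} → rank c < rank d → (c ∷ xs) ≺ (d ∷ ys)
  head<⇒≺ {c} {d} {xs} {ys} c<d = ≺-intro (lex≤-head> d c ys xs c<d)

  ∷-≺ : ∀ {c d : Sym k} {xs ys} → rank c ≡ rank d → xs ≺ ys → (c ∷ xs) ≺ (d ∷ ys)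
  ∷-≺ {c} {d} {xs} {ys} c≡d xs≺ys =
    ≺-intro (trans (lex≤-head≡ d c ys xs (sym c≡d)) (≰ xs≺ys))

  ∷-≺⁻ : ∀ {c d : Sym k} {xs ys} → (c ∷ xs) ≺ (d ∷ ys) →
         rank c < rank d ⊎ (rank c ≡ rank d × xs ≺ ys)
  ∷-≺⁻ {c} {d} {xs} {ys} (≺-intro ≰) with <-cmp (rank c) (rank d)
  ... | tri< c<d _ _ = inj₁ c<d
  ... | tri≈ _ c≡d _ = inj₂ (c≡d , ≺-intro (trans (sym (lex≤-head≡ d c ys xs (sym c≡d))) ≰))
  ... | tri> _ _ d<c with () ← trans (sym (lex≤-head< d c ys xs d<c)) ≰

  ≺⇒lex≤ : ∀ {xs ys : List (Sym k)} → xs ≺ ys → lex≤ xs ys ≡ true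
  ≺⇒lex≤ {[]}     _ = refl
  ≺⇒lex≤ {_ ∷ _}  {[]} (≺-intro ())
  ≺⇒lex≤ {c ∷ xs} {d ∷ ys} xs≺ys with ∷-≺⁻ xs≺ys
  ... | inj₁ c<d          = lex≤-head< c d xs ys c<d
  ... | inj₂ (c≡d , tail) = trans (lex≤-head≡ c d xs ys c≡d) (≺⇒lex≤ tail)

  ≺-trans : ∀ {xs ys zs : List (Sym k)} → xs ≺ ys → ys ≺ zs → xs ≺ zs
  ≺-trans {ys = []} (≺-intro ()) _
  ≺-trans {ys = _ ∷ _} {zs = []} _ (≺-intro ())
  ≺-trans {xs = []} {ys = _ ∷ _} {zs = _ ∷ _} _ _ = ≺-intro refl
  ≺-trans {xs = _ ∷ _} {ys = _ ∷ _} {zs = _ ∷ _} p q with ∷-≺⁻ p | ∷-≺⁻ q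
  ... | inj₁ a<b       | inj₁ b<c       = head<⇒≺ (<-trans a<b b<c)
  ... | inj₁ a<b       | inj₂ (b≡c , _) = head<⇒≺ (<-≤-trans a<b (≤-reflexive b≡c))
  ... | inj₂ (a≡b , _) | inj₁ b<c       = head<⇒≺ (≤-<-trans (≤-reflexive a≡b) b<c)
  ... | inj₂ (a≡b , p) | inj₂ (b≡c , q) = ∷-≺ (trans a≡b b≡c) (≺-trans p q)

  Sorted : List (List (Sym k)) → Set
  Sorted = AllPairs _≺_

  insertLex-between : ∀ x (xs ys : List (List (Sym k))) → All (_≺ x) xs → All (x ≺_) ys →
                      insertLex x (xs ++ ys) ≡ xs ++ x ∷ ys
  insertLex-between x []       []       _          _          = refl
  insertLex-between x []       (y ∷ ys) _          (x≺y ∷ _)  rewrite ≺⇒lex≤ x≺y = refl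
  insertLex-between x (y ∷ xs) ys       (y≺x ∷ hs) hys        rewrite ≰ y≺x =
    cong (y ∷_) (insertLex-between x xs ys hs hys)

  Sorted-split : ∀ xs {x ys} → Sorted (xs ++ x ∷ ys) →
                 All (_≺ x) xs × All (x ≺_) ys × Sorted (xs ++ ys)
  Sorted-split []       (x≺ys ∷ s) = [] , x≺ys , s
  Sorted-split (y ∷ xs) (y≺ ∷ s) with Sorted-split xs s | All.++⁻ xs y≺
  ... | xs≺x , x≺ys , s′ | y≺xs , (y≺x ∷ y≺ys) =
    y≺x ∷ xs≺x , x≺ys , All.++⁺ y≺xs y≺ys ∷ s′

  sortLex-unique : ∀ xs {ys} → Sorted ys → xs ↭ ys → sortLex xs ≡ ys
  sortLex-unique []       _ xs↭ys rewrite ↭-empty-inv (↭-sym xs↭ys) = refl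
  sortLex-unique (x ∷ xs) s xs↭ys with ∈-∃++ (∈-resp-↭ xs↭ys (here refl))
  ... | before , after , refl with Sorted-split before s
  ... | before≺x , x≺after , s′ = begin
    insertLex x (sortLex xs)
      ≡⟨ cong (insertLex x) (sortLex-unique xs s′ (drop-mid [] before xs↭ys)) ⟩
    insertLex x (before ++ after)
      ≡⟨ insertLex-between x before after before≺x x≺after ⟩
    before ++ x ∷ after ∎
    where open ≡-Reasoning

  HeadRank : (ℕ → Set) → List (Sym k) → Set
  HeadRank P []      = ⊥
  HeadRank P (c ∷ _) = P (rank c)

  separatedByHead : ∀ n {xss yss} → All (HeadRank (_< n)) xss → All (HeadRank (n ≤_)) yss →
                    All (λ xs → All (xs ≺_) yss) xss
  separatedByHead n xss<n n≤yss = All.map (λ xs<n → All.map (≺-across xs<n) n≤yss) xss<n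
    where
    ≺-across : ∀ {xs ys} → HeadRank (_< n) xs → HeadRank (n ≤_) ys → xs ≺ ys
    ≺-across {_ ∷ _} {_ ∷ _} c<n n≤d = head<⇒≺ (<-≤-trans c<n n≤d)

rotationsFrom : ∀ {A : Set} → List A → List A → List (List A)
rotationsFrom p []      = []
rotationsFrom p (x ∷ s) = (x ∷ s ++ p) ∷ rotationsFrom (p ∷ʳ x) s

module _ {A : Set} where

  drop-length-++ : ∀ (xs ys : List A) → drop (length xs) (xs ++ ys) ≡ ys
  drop-length-++ []       ys = refl
  drop-length-++ (x ∷ xs) ys = drop-length-++ xs ys

  take-length-++ : ∀ (xs ys : List A) → take (length xs) (xs ++ ys) ≡ xs
  take-length-++ []       ys = refl
  take-length-++ (x ∷ xs) ys = cong (x ∷_) (take-length-++ xs ys)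

  rotationAt : List A → ℕ → List A
  rotationAt w j = drop j w ++ take j w

  applyUpTo-rotationAt : ∀ w p s → w ≡ p ++ s →
                         applyUpTo (λ j → rotationAt w (length p + j)) (length s) ≡ rotationsFrom p s
  applyUpTo-rotationAt w p []      _    = refl
  applyUpTo-rotationAt w p (x ∷ s) refl = cong₂ _∷_ first rest
    where
    first : rotationAt w (length p + 0) ≡ x ∷ s ++ p
    first rewrite +-identityʳ (length p) | drop-length-++ p (x ∷ s) | take-length-++ p (x ∷ s) = refl

    length-∷ʳ : ∀ j → length p + suc j ≡ length (p ∷ʳ x) + j
    length-∷ʳ j = trans (+-suc (length p) j)
                        (cong (_+ j) (trans (+-comm 1 (length p)) (sym (length-++ p))))

    rest : applyUpTo (λ j → rotationAt w (length p + suc j)) (length s) ≡ rotationsFrom (p ∷ʳ x) s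
    rest = trans (applyUpTo-cong (cong (rotationAt w) ∘ length-∷ʳ) (length s))
                 (applyUpTo-rotationAt w (p ∷ʳ x) s (sym (++-assoc p [ x ] s)))

  rotations≡rotationsFrom : ∀ w → rotations w ≡ rotationsFrom [] w
  rotations≡rotationsFrom w =
    trans (map-applyUpTo id (rotationAt w) (length w)) (applyUpTo-rotationAt w [] w refl)

module _ {k : ℕ} where

  block : Fin k → List (Sym k)
  block i = sb ∷ sa ∷ hash i ∷ sa ∷ amp i ∷ []

  -- ⟨ p , i , s ⟩ is the occurrence of block i in the string p ++ block i ++ s.
  record Position : Set where
    constructor ⟨_,_,_⟩
    field
      before : List (Sym k)
      index  : Fin k
      after  : List (Sym k)
  open Position

  positions : List (Sym k) → List (Fin k) → List Position
  positions p []       = []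
  positions p (i ∷ is) = ⟨ p , i , concatMap block is ⟩ ∷ positions (p ++ block i) is

  -- The prefixes are built with ∷ʳ so that rotationsFrom p (block i ++ s) unfolds to these definitionally.
  rot-b rot-a# rot-# rot-a& rot-& : Position → List (Sym k)
  rot-b  ⟨ p , i , s ⟩ = sb ∷ sa ∷ hash i ∷ sa ∷ amp i ∷ s ++ p
  rot-a# ⟨ p , i , s ⟩ = sa ∷ hash i ∷ sa ∷ amp i ∷ s ++ p ∷ʳ sb
  rot-#  ⟨ p , i , s ⟩ = hash i ∷ sa ∷ amp i ∷ s ++ p ∷ʳ sb ∷ʳ sa
  rot-a& ⟨ p , i , s ⟩ = sa ∷ amp i ∷ s ++ p ∷ʳ sb ∷ʳ sa ∷ʳ hash i
  rot-&  ⟨ p , i , s ⟩ = amp i ∷ s ++ p ∷ʳ sb ∷ʳ sa ∷ʳ hash i ∷ʳ sa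

  blockRotations separatorRotations aRotations bRotations : Position → List (List (Sym k))
  blockRotations     w = rot-b w ∷ rot-a# w ∷ rot-# w ∷ rot-a& w ∷ rot-& w ∷ []
  separatorRotations w = rot-# w ∷ rot-& w ∷ []
  aRotations         w = rot-a# w ∷ rot-a& w ∷ []
  bRotations         w = rot-b w ∷ []

  hashPairs : List (Fin k) → List (Sym k)
  hashPairs = concatMap (λ i → sb ∷ hash i ∷ [])

  sortedRotations : List Position → List (List (Sym k))
  sortedRotations ws =
    concatMap separatorRotations ws ++ concatMap aRotations ws ++ concatMap bRotations ws

  ∷ʳ-block : ∀ p i → p ∷ʳ sb ∷ʳ sa ∷ʳ hash i ∷ʳ sa ∷ʳ amp i ≡ p ++ block i
  ∷ʳ-block []      i = refl
  ∷ʳ-block (x ∷ p) i = cong (x ∷_) (∷ʳ-block p i)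

  rotationsFrom-blocks : ∀ p is →
                         rotationsFrom p (concatMap block is) ≡ concatMap blockRotations (positions p is)
  rotationsFrom-blocks p []       = refl
  rotationsFrom-blocks p (i ∷ is) = cong (blockRotations ⟨ p , i , concatMap block is ⟩ ++_) (begin
    rotationsFrom (p ∷ʳ sb ∷ʳ sa ∷ʳ hash i ∷ʳ sa ∷ʳ amp i) (concatMap block is)
      ≡⟨ cong (λ q → rotationsFrom q (concatMap block is)) (∷ʳ-block p i) ⟩
    rotationsFrom (p ++ block i) (concatMap block is)
      ≡⟨ rotationsFrom-blocks (p ++ block i) is ⟩
    concatMap blockRotations (positions (p ++ block i) is) ∎)
    where open ≡-Reasoning

  blockRotations-↭ : ∀ w → blockRotations w ↭ separatorRotations w ++ aRotations w ++ bRotations w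
  blockRotations-↭ w =
    ↭-trans (++-comm [ rot-b w ] _)
   (↭-trans (swap (rot-a# w) (rot-# w) ↭-refl)
            (prep (rot-# w) (shift (rot-& w) (aRotations w) (bRotations w))))

  rotations-↭-sortedRotations : ∀ ws → concatMap blockRotations ws ↭ sortedRotations ws
  rotations-↭-sortedRotations ws = begin
    concatMap blockRotations ws
      ↭⟨ concatMap-↭ blockRotations-↭ ws ⟩
    concatMap (λ w → separatorRotations w ++ aRotations w ++ bRotations w) ws
      ↭⟨ concatMap-++-↭ separatorRotations (λ w → aRotations w ++ bRotations w) ws ⟩
    concatMap separatorRotations ws ++ concatMap (λ w → aRotations w ++ bRotations w) ws
      ↭⟨ ++⁺ˡ (concatMap separatorRotations ws) (concatMap-++-↭ aRotations bRotations ws) ⟩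
    sortedRotations ws ∎
    where open PermutationReasoning

  module _ (f g : Position → List (Sym k))
           (f≺g : ∀ {w} → f w ≺ g w)
           (g≺f : ∀ {w w′} → index w Fin.< index w′ → g w ≺ f w′) where

    pairs-linked : ∀ p {is} → Linked Fin._<_ is →
                   Linked _≺_ (concatMap (λ w → f w ∷ g w ∷ []) (positions p is))
    pairs-linked p []        = []
    pairs-linked p [-]       = f≺g ∷ [-]
    pairs-linked p (i<j ∷ l) = f≺g ∷ g≺f i<j ∷ pairs-linked _ l

  module _ (f : Position → List (Sym k))
           (f≺f : ∀ {w w′} → index w Fin.< index w′ → f w ≺ f w′) where

    singletons-linked : ∀ p {is} → Linked Fin._<_ is →
                        Linked _≺_ (concatMap (λ w → f w ∷ []) (positions p is))
    singletons-linked p []        = []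
    singletons-linked p [-]       = [-]
    singletons-linked p (i<j ∷ l) = f≺f i<j ∷ singletons-linked _ l

  sortedRotations-sorted : ∀ p {is} → Linked Fin._<_ is → Sorted (sortedRotations (positions p is))
  sortedRotations-sorted p {is} is↗ =
    AllPairs.++⁺ separators-sorted (AllPairs.++⁺ a-sorted b-sorted a≺b) separators≺rest
    where
    ws = positions p is
    chain = Linked⇒AllPairs ≺-trans

    separators-sorted : Sorted (concatMap separatorRotations ws)
    separators-sorted =
      chain (pairs-linked rot-# rot-& (head<⇒≺ (n<1+n _)) (head<⇒≺ ∘ m<n⇒1+2m<2n) p is↗)

    a-sorted : Sorted (concatMap aRotations ws)
    a-sorted = chain (pairs-linked rot-a# rot-a& (∷-≺ refl (head<⇒≺ (n<1+n _)))
                                   (∷-≺ refl ∘ head<⇒≺ ∘ m<n⇒1+2m<2n) p is↗)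

    b-sorted : Sorted (concatMap bRotations ws)
    b-sorted =
      chain (singletons-linked rot-b (∷-≺ refl ∘ ∷-≺ refl ∘ head<⇒≺ ∘ *-monoʳ-< 2) p is↗)

    a≺b : All (λ xs → All (xs ≺_) (concatMap bRotations ws)) (concatMap aRotations ws)
    a≺b = separatedByHead (suc (2 * k)) (All-concatMap⁺ (λ _ → n<1+n _ ∷ n<1+n _ ∷ []) ws)
                                        (All-concatMap⁺ (λ _ → ≤-refl ∷ []) ws)

    separators≺rest : All (λ xs → All (xs ≺_) (concatMap aRotations ws ++ concatMap bRotations ws))
                          (concatMap separatorRotations ws)
    separators≺rest = separatedByHead (2 * k)
      (All-concatMap⁺ (λ w → let i<k = toℕ<n (index w) in *-monoʳ-< 2 i<k ∷ m<n⇒1+2m<2n i<k ∷ []) ws)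
      (All.++⁺ (All-concatMap⁺ (λ _ → ≤-refl ∷ ≤-refl ∷ []) ws)
               (All-concatMap⁺ (λ _ → n≤1+n _ ∷ []) ws))

  lastChars : List (List (Sym k)) → List (Sym k)
  lastChars = concatMap lastL

  lastChars-separatorRotations : ∀ p is →
    lastChars (concatMap separatorRotations (positions p is)) ≡ replicate (2 * length is) sa
  lastChars-separatorRotations p []       = refl
  lastChars-separatorRotations p (i ∷ is) =
    trans (cong₂ _++_ (lastL-++-∷ʳ (hash i ∷ sa ∷ amp i ∷ s) (p ∷ʳ sb) sa)
            (cong₂ _++_ (lastL-++-∷ʳ (amp i ∷ s) (p ∷ʳ sb ∷ʳ sa ∷ʳ hash i) sa)
                        (lastChars-separatorRotations (p ++ block i) is)))
          (cong (λ n → replicate n sa) (sym (*-suc 2 (length is))))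
    where s = concatMap block is

  lastChars-aRotations : ∀ p is → lastChars (concatMap aRotations (positions p is)) ≡ hashPairs is
  lastChars-aRotations p []       = refl
  lastChars-aRotations p (i ∷ is) =
    cong₂ _++_ (lastL-++-∷ʳ (sa ∷ hash i ∷ sa ∷ amp i ∷ s) p sb)
      (cong₂ _++_ (lastL-++-∷ʳ (sa ∷ amp i ∷ s) (p ∷ʳ sb ∷ʳ sa) (hash i))
                  (lastChars-aRotations (p ++ block i) is))
    where s = concatMap block is

  lastL-rot-b : ∀ p j i s → lastL (rot-b ⟨ p ++ block j , i , s ⟩) ≡ [ amp j ]
  lastL-rot-b p j i s = trans (cong lastL (sym (++-assoc b-prefix p (block j))))
                              (lastL-++-∷ʳ (b-prefix ++ p) (sb ∷ sa ∷ hash j ∷ sa ∷ []) (amp j))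
    where b-prefix = sb ∷ sa ∷ hash i ∷ sa ∷ amp i ∷ s

  lastL-rot-b-first : ∀ i is →
                      lastL (rot-b ⟨ [] , i , concatMap block is ⟩) ≡ [ amp (last⁺ i is) ]
  lastL-rot-b-first i []       = refl
  lastL-rot-b-first i (j ∷ is) = lastL-rot-b-first j is

  lastChars-bRotations-after : ∀ p j is →
    lastChars (concatMap bRotations (positions (p ++ block j) is)) ≡ map amp (init⁺ j is)
  lastChars-bRotations-after p j []       = refl
  lastChars-bRotations-after p j (i ∷ is) =
    cong₂ _++_ (lastL-rot-b p j i (concatMap block is))
               (lastChars-bRotations-after (p ++ block j) i is)

  lastChars-bRotations : ∀ i is →
    lastChars (concatMap bRotations (positions [] (i ∷ is))) ≡ map amp (last⁺ i is ∷ init⁺ i is)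
  lastChars-bRotations i is = cong₂ _++_ (lastL-rot-b-first i is) (lastChars-bRotations-after [] i is)

BWT-u : ∀ m → BWT (u (suc m)) ≡ bwtTarget m
BWT-u m = begin
  lastChars (sortLex (rotations (u K)))
    ≡⟨ cong (lastChars ∘ sortLex) rotations-u ⟩
  lastChars (sortLex (concatMap blockRotations ws))
    ≡⟨ cong lastChars (sortLex-unique _ sorted (rotations-↭-sortedRotations ws)) ⟩
  lastChars (Seps ++ As ++ Bs)
    ≡⟨ concatMap-++ lastL Seps (As ++ Bs) ⟩
  lastChars Seps ++ lastChars (As ++ Bs)
    ≡⟨ cong (lastChars Seps ++_) (concatMap-++ lastL As Bs) ⟩
  lastChars Seps ++ lastChars As ++ lastChars Bs
    ≡⟨ cong₂ _++_ lastChars-Seps (cong₂ _++_ (lastChars-aRotations [] (allFin K)) lastChars-Bs) ⟩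
  bwtTarget m ∎
  where
  open ≡-Reasoning
  K = suc m
  ws = positions [] (allFin K)
  Seps = concatMap separatorRotations ws
  As = concatMap aRotations ws
  Bs = concatMap bRotations ws

  rotations-u : rotations (u K) ≡ concatMap blockRotations ws
  rotations-u = trans (rotations≡rotationsFrom (u K)) (rotationsFrom-blocks [] (allFin K))

  sorted : Sorted (Seps ++ As ++ Bs)
  sorted = sortedRotations-sorted [] (allFin-↗ K)

  lastChars-Seps : lastChars Seps ≡ replicate (2 * K) sa
  lastChars-Seps = trans (lastChars-separatorRotations [] (allFin K))
                         (cong (λ n → replicate (2 * n) sa) (length-tabulate {n = K} id))

  lastChars-Bs : lastChars Bs ≡ amp (fromℕ m) ∷ map (amp ∘ inject₁) (allFin m)
  lastChars-Bs = begin
    lastChars Bs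
      ≡⟨ lastChars-bRotations fzero (tabulate fsuc) ⟩
    map amp (last⁺ fzero (tabulate fsuc) ∷ init⁺ fzero (tabulate fsuc))
      ≡⟨ cong₂ (λ i is → amp i ∷ map amp is) (last⁺-tabulate m id) (init⁺-tabulate m id) ⟩
    amp (fromℕ m) ∷ map amp (tabulate inject₁)
      ≡⟨ cong (amp (fromℕ m) ∷_) (map-tabulate inject₁ amp) ⟩
    amp (fromℕ m) ∷ tabulate (amp ∘ inject₁)
      ≡⟨ cong (amp (fromℕ m) ∷_) (sym (map-tabulate id (amp ∘ inject₁))) ⟩
    amp (fromℕ m) ∷ map (amp ∘ inject₁) (allFin m) ∎

module _ {k : ℕ} where

  Distinct : Sym k → Sym k → Set
  Distinct x y = rank x ≢ rank y

  runs-∷-≡ : ∀ (c : Sym k) ys → runs (c ∷ c ∷ ys) ≡ runs (c ∷ ys)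
  runs-∷-≡ c ys rewrite T⇒≡true (≡⇒≡ᵇ (rank c) (rank c) refl) = refl

  runs-∷-≉ : ∀ x y ys → Distinct x y → runs (x ∷ y ∷ ys) ≡ suc (runs (y ∷ ys))
  runs-∷-≉ x y ys x≉y rewrite ¬T⇒≡false (x≉y ∘ ≡ᵇ⇒≡ _ _) = refl

  runs-distinct : ∀ {xs} → Linked Distinct xs → runs xs ≡ length xs
  runs-distinct []  = refl
  runs-distinct [-] = refl
  runs-distinct {x ∷ y ∷ ys} (x≉y ∷ xs) =
    trans (runs-∷-≉ x y ys x≉y) (cong suc (runs-distinct xs))

  runs-replicate-++ : ∀ n .{{_ : NonZero n}} (c : Sym k) {ys} → HeadRank (rank c ≢_) ys →
                      runs (replicate n c ++ ys) ≡ suc (runs ys)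
  runs-replicate-++ 1             c {y ∷ ys} c≉y  = runs-∷-≉ c y ys c≉y
  runs-replicate-++ (suc (suc n)) c {ys}     c≉ys =
    trans (runs-∷-≡ c (replicate n c ++ ys)) (runs-replicate-++ (suc n) c c≉ys)

  ∷-distinct : ∀ {x n ys} → rank x ≤ n → HeadRank (n <_) ys → Linked Distinct ys →
               Linked Distinct (x ∷ ys)
  ∷-distinct {ys = []}    _   _   _  = [-]
  ∷-distinct {ys = _ ∷ _} x≤n n<y ys = <⇒≢ (≤-<-trans x≤n n<y) ∷ ys

  length-hashPairs : ∀ is → length (hashPairs {k} is) ≡ 2 * length is
  length-hashPairs []       = refl
  length-hashPairs (i ∷ is) = trans (cong (suc ∘ suc) (length-hashPairs is)) (sym (*-suc 2 (length is)))

hashPairs-++-distinct : ∀ m is {ys} → HeadRank (2 * m <_) ys → Linked Distinct ys →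
                        HeadRank (2 * m <_) (hashPairs is ++ ys) × Linked Distinct (hashPairs {suc m} is ++ ys)
hashPairs-++-distinct m []       ys-high ys = ys-high , ys
hashPairs-++-distinct m (i ∷ is) ys-high ys with hashPairs-++-distinct m is ys-high ys
... | rest-high , rest =
  s≤s (*-monoʳ-≤ 2 (n≤1+n m)) ,
  >⇒≢ (s≤s (*-monoʳ-≤ 2 (<⇒≤ (toℕ<n i)))) ∷
  ∷-distinct (*-monoʳ-≤ 2 (≤-pred (toℕ<n i))) rest-high rest

amps-distinct : ∀ m → Linked Distinct (amp (fromℕ m) ∷ map (amp ∘ inject₁) (allFin m))
amps-distinct zero    = [-]
amps-distinct (suc m) = (λ ()) ∷ Linked.map⁺ (Linked.map inject₁-distinct (allFin-↗ (suc m)))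
  where
  inject₁-distinct : ∀ {i j : Fin (suc m)} → i Fin.< j →
                     Distinct {suc (suc m)} (amp (inject₁ i)) (amp (inject₁ j))
  inject₁-distinct {i} {j} i<j
    rewrite toℕ-inject₁ i | toℕ-inject₁ j = <⇒≢ (s≤s (*-monoʳ-< 2 i<j))

runs-bwtTarget : ∀ m → runs (bwtTarget m) ≡ 3 * suc m + 1
runs-bwtTarget m = begin
  runs (replicate (2 * K) sa ++ rest) ≡⟨ runs-replicate-++ (2 * K) sa (<⇒≢ (n<1+n (2 * K))) ⟩
  suc (runs rest)                     ≡⟨ cong suc (runs-distinct rest-distinct) ⟩
  suc (length rest)                   ≡⟨ cong suc length-rest ⟩
  suc (2 * K + K)                     ≡⟨ cong suc (+-comm (2 * K) K) ⟩
  suc (3 * K)                         ≡⟨ +-comm 1 (3 * K) ⟩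
  3 * K + 1                           ∎
  where
  open ≡-Reasoning
  K = suc m
  amps = amp (fromℕ m) ∷ map (amp ∘ inject₁) (allFin m)
  rest = hashPairs (allFin K) ++ amps

  amps-high : HeadRank (2 * m <_) amps
  amps-high = s≤s (≤-reflexive (cong (2 *_) (sym (toℕ-fromℕ m))))

  rest-distinct : Linked Distinct rest
  rest-distinct = proj₂ (hashPairs-++-distinct m (allFin K) amps-high (amps-distinct m))

  length-rest : length rest ≡ 2 * K + K
  length-rest = trans (length-++ (hashPairs (allFin K)))
    (cong₂ _+_ (trans (length-hashPairs (allFin K)) (cong (2 *_) (length-tabulate {n = K} id)))
               (cong suc (trans (length-map _ (allFin m)) (length-tabulate {n = m} id))))

lemma3p2 : (m : ℕ) → BWT (u (suc m)) ≡ bwtTarget m × r (u (suc m)) ≡ 3 * suc m + 1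
lemma3p2 m = BWT-u m , trans (cong runs (BWT-u m)) (runs-bwtTarget m)
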